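{- Let $\mathcal{F}(x,y;q)=\sum_{n\ge 1}\big(\sum_{\ell=0}^{n-1}\sum_{k=0}^{\ell} f_n(k,\ell)x^ky^\ell\big)q^n$. Then, as formal power series in $q$ (equivalently for $q$ in a sufficiently small neighborhood of $0$), $$\mathcal{F}(x,1;q)=\frac{1-q}{1-xq}\mathcal{F}(1,1;q).$$
   Context: An inversion sequence of length $n$ is a sequence $e=e_1\cdots e_n$ of integers with $0\le e_i\le i-1$. The reduction of a word replaces each occurrence of the $k$-th smallest distinct entry by $k-1$; $e$ contains a pattern $p$ if some subsequence (entries at increasing positions) has reduction $p$, and avoids $p$ otherwise. $\mathbf{I}_n(0012)$ is the set of inversion sequences of length $n$ avoiding $0012$. For $e\in\mathbf{I}_n(0012)$, $\mathcal{R}(e)$ is the set of values appearing at least twice in $e$, $\textsc{srpt}(e)=\min\mathcal{R}(e)$ with the convention $\textsc{srpt}(01\cdots(n-1))=n-1$, and $\textsc{last}(e)=e_n$. $f_n(k,\ell)$ is the number of $e\in\mathbf{I}_n(0012)$ with $\textsc{srpt}(e)=k$ and $\textsc{last}(e)=\ell$. -}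

module Defs where

open import Data.Bool using (Bool; true; false; _∧_; not; if_then_else_)
open import Data.Nat using (ℕ; zero; suc; _∸_; _<ᵇ_; _≤ᵇ_; _≡ᵇ_)
open import Data.List using (List; []; _∷_; _++_; [_]; map; concatMap; length; upTo; filterᵇ; deduplicateᵇ; foldr)
open import Data.Bool.ListAction using (any)
open import Data.Integer using (ℤ; +_; -[1+_]) renaming (_+_ to _+ℤ_; _*_ to _*ℤ_)

-- Inversion sequences of length n, e = e₁ ⋯ eₙ with 0 ≤ eᵢ ≤ i-1,
-- represented as lists of naturals.

invSeqs : ℕ → List (List ℕ)
invSeqs zero    = [] ∷ []
invSeqs (suc n) = concatMap (λ e → map (λ v → e ++ [ v ]) (upTo (suc n))) (invSeqs n)

subseqs : List ℕ → List (List ℕ)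
subseqs []       = [] ∷ []
subseqs (x ∷ xs) = map (x ∷_) (subseqs xs) ++ subseqs xs

listEq : List ℕ → List ℕ → Bool
listEq []       []       = true
listEq (x ∷ xs) (y ∷ ys) = (x ≡ᵇ y) ∧ listEq xs ys
listEq _        _        = false

-- reduction: the k-th smallest distinct entry is replaced by k-1,
-- i.e. each entry x is replaced by the number of distinct entries < x.
reduce : List ℕ → List ℕ
reduce w = map (λ x → length (deduplicateᵇ _≡ᵇ_ (filterᵇ (λ y → y <ᵇ x) w))) w

contains : List ℕ → List ℕ → Bool
contains p e = any (λ s → listEq (reduce s) p) (subseqs e)

avoids : List ℕ → List ℕ → Bool
avoids p e = not (contains p e)

p0012 : List ℕ
p0012 = 0 ∷ 0 ∷ 1 ∷ 2 ∷ []

count : ℕ → List ℕ → ℕ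
count v e = length (filterᵇ (λ y → y ≡ᵇ v) e)

repeated : List ℕ → ℕ → Bool
repeated e v = 2 ≤ᵇ count v e

firstOr : ℕ → (ℕ → Bool) → List ℕ → ℕ
firstOr d P []       = d
firstOr d P (x ∷ xs) = if P x then x else firstOr d P xs

-- srpt(e) = min R(e) (entries of e ∈ I_n are < n, so searching 0..n-1
-- in increasing order finds the minimum); n-1 if R(e) is empty
-- (which for inversion sequences happens exactly for e = 01⋯(n-1)).
srpt : ℕ → List ℕ → ℕ
srpt n e = firstOr (n ∸ 1) (repeated e) (upTo n)

-- last(e) = eₙ (the default 0 is never used for n ≥ 1)
lastOf : List ℕ → ℕ
lastOf []           = 0
lastOf (x ∷ [])     = x
lastOf (x ∷ y ∷ ys) = lastOf (y ∷ ys)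

f : ℕ → ℕ → ℕ → ℕ
f n k ℓ = length (filterᵇ (λ e → avoids p0012 e ∧ ((srpt n e ≡ᵇ k) ∧ (lastOf e ≡ᵇ ℓ))) (invSeqs n))

-- Formal power series in x and q with integer coefficients,
-- represented by coefficient functions: S n k = [q^n x^k] S.

Series : Set
Series = ℕ → ℕ → ℤ

Σℤ : List ℕ → (ℕ → ℤ) → ℤ
Σℤ xs g = foldr (λ i acc → g i +ℤ acc) (+ 0) xs

_⊛_ : Series → Series → Series
(S ⊛ T) n k = Σℤ (upTo (suc n)) (λ i → Σℤ (upTo (suc k)) (λ j → S i j *ℤ T (n ∸ i) (k ∸ j)))

-- 1/(1 - xq) = Σ_{j≥0} x^j q^j
geomXQ : Series
geomXQ n k = if n ≡ᵇ k then + 1 else + 0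

oneMinusQ : Series
oneMinusQ 0       0 = + 1
oneMinusQ 1       0 = -[1+ 0 ]
oneMinusQ _       _ = + 0

-- [q^n x^k y^ℓ] F(x,y;q) : f_n(k,ℓ) if n ≥ 1, 0 ≤ k ≤ ℓ ≤ n-1, else 0
Fcoef : ℕ → ℕ → ℕ → ℤ
Fcoef zero    k ℓ = + 0
Fcoef (suc m) k ℓ = if (k ≤ᵇ ℓ) ∧ (ℓ ≤ᵇ m) then + f (suc m) k ℓ else + 0

-- F(x,1;q): [q^n x^k] = Σ_ℓ [q^n x^k y^ℓ] F  (ℓ ranges over 0..n-1)
Fx1 : Series
Fx1 n k = Σℤ (upTo n) (λ ℓ → Fcoef n k ℓ)

-- F(1,1;q): a series in q only, [q^n x^0] = Σ_{k,ℓ} [q^n x^k y^ℓ] F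
F11 : Series
F11 n zero    = Σℤ (upTo n) (λ ℓ → Σℤ (upTo n) (λ k → Fcoef n k ℓ))
F11 n (suc _) = + 0

module Submission where

-- For n ≥ 1, e ↦ 0(e+1) is a bijection from I_n onto the sequences of I_{n+1}
-- whose 0 is not repeated, i.e. those with srpt ≥ 1. It preserves
-- 0012-avoidance and raises srpt and last by one, so f_{n+1}(k+1,ℓ+1) = f_n(k,ℓ).
-- Hence [q^{n+1} x^{k+1}] F(x,1;q) = [q^n x^k] F(x,1;q): the series
-- (1 - xq) F(x,1;q) has only x⁰-terms, and these are (1 - q) F(1,1;q) because
-- [q^n] F(1,1;q) = Σ_k [q^n x^k] F(x,1;q) and the shift relation gives
-- [q^{n+1}] F(1,1;q) = [q^{n+1} x⁰] F(x,1;q) + [q^n] F(1,1;q).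

open import Defs
open import Data.Bool using (Bool; true; false; _∧_; _∨_; not; if_then_else_; T; T?)
open import Data.Bool.Properties using (∧-zeroʳ; ∨-assoc; not-injective; if-float)
open import Data.Bool.ListAction using (any; or)
open import Data.Nat using (ℕ; zero; suc; _+_; _∸_; _<ᵇ_; _≤ᵇ_; _≡ᵇ_)
open import Data.Nat.Properties using (+-identityʳ; +-comm)
open import Data.List
  using (List; []; _∷_; _++_; [_]; map; concat; concatMap; length; upTo; applyUpTo; filter; filterᵇ; deduplicateᵇ)
open import Data.List.Properties
  using (map-++; map-∘; map-cong; map-cong-local; length-map; length-++; filter-++; filter-reject; map-applyUpTo; concatMap-cong; concatMap-map; map-concatMap; foldr-map)
open import Data.List.Relation.Unary.All as All using (All; []; _∷_)
open import Data.List.Relation.Unary.All.Properties using (concat⁺; map⁺)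
open import Data.Product using (∃-syntax; _,_)
open import Data.Integer using (ℤ; +_; -[1+_]; -_; _-_) renaming (_+_ to _+ℤ_; _*_ to _*ℤ_)
import Data.Integer.Properties as ℤ
open import Algebra.Properties.CommutativeSemigroup ℤ.+-commutativeSemigroup using (interchange)
open import Function using (_∘_; id)
open import Relation.Nullary using (does; ¬?)
open import Relation.Unary using (Decidable)
open import Relation.Binary.PropositionalEquality
  using (_≡_; refl; sym; trans; cong; cong₂; subst; _≗_; module ≡-Reasoning)
open ≡-Reasoning

filter-map : {A B : Set} {P : A → Set} {Q : B → Set} (P? : Decidable P) (Q? : Decidable Q) (h : A → B) →
             (∀ x → does (Q? (h x)) ≡ does (P? x)) → filter Q? ∘ map h ≗ map h ∘ filter P?
filter-map P? Q? h same [] = refl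
filter-map P? Q? h same (x ∷ xs) with does (Q? (h x)) | does (P? x) | same x
... | true  | .true  | refl = cong (h x ∷_) (filter-map P? Q? h same xs)
... | false | .false | refl = filter-map P? Q? h same xs

filterᵇ-map : {A B : Set} (p : B → Bool) (h : A → B) → filterᵇ p ∘ map h ≗ map h ∘ filterᵇ (p ∘ h)
filterᵇ-map p h = filter-map _ _ h (λ _ → refl)

filterᵇ-concatMap : {A B : Set} (p : B → Bool) (g : A → List B) →
                    filterᵇ p ∘ concatMap g ≗ concatMap (filterᵇ p ∘ g)
filterᵇ-concatMap p g []       = refl
filterᵇ-concatMap p g (x ∷ xs) =
  trans (filter-++ (T? ∘ p) (g x) (concatMap g xs)) (cong (filterᵇ p (g x) ++_) (filterᵇ-concatMap p g xs))

filterᵇ-reject : {A : Set} (p : A → Bool) {x : A} (xs : List A) → p x ≡ false → filterᵇ p (x ∷ xs) ≡ filterᵇ p xs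
filterᵇ-reject p xs px = filter-reject (T? ∘ p) (subst T px)

filterᵇ-const : {A : Set} (p : A → Bool) (b : Bool) → (∀ x → p x ≡ b) → ∀ xs → filterᵇ p xs ≡ (if b then xs else [])
filterᵇ-const p true  p≡b []       = refl
filterᵇ-const p false p≡b []       = refl
filterᵇ-const p true  p≡b (x ∷ xs) rewrite p≡b x = cong (x ∷_) (filterᵇ-const p true p≡b xs)
filterᵇ-const p false p≡b (x ∷ xs) rewrite p≡b x = filterᵇ-const p false p≡b xs

filterᵇ-cong-local : {A : Set} {p q : A → Bool} {xs : List A} → All (λ x → p x ≡ q x) xs → filterᵇ p xs ≡ filterᵇ q xs
filterᵇ-cong-local [] = refl
filterᵇ-cong-local {p = p} {q} {x ∷ xs} (px≡qx ∷ rest) with p x | q x | px≡qx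
... | true  | .true  | refl = cong (x ∷_) (filterᵇ-cong-local rest)
... | false | .false | refl = filterᵇ-cong-local rest

filterᵇ-absorb : {A : Set} (p q : A → Bool) → (∀ x → q x ≡ false → p x ≡ false) → filterᵇ p ∘ filterᵇ q ≗ filterᵇ p
filterᵇ-absorb p q q⇒p [] = refl
filterᵇ-absorb p q q⇒p (x ∷ xs) with q x in qx
... | true with p x
...   | true  = cong (x ∷_) (filterᵇ-absorb p q q⇒p xs)
...   | false = filterᵇ-absorb p q q⇒p xs
filterᵇ-absorb p q q⇒p (x ∷ xs) | false =
  trans (filterᵇ-absorb p q q⇒p xs) (sym (filterᵇ-reject p xs (q⇒p x qx)))

concatMap-filterᵇ : {A B : Set} (q : A → Bool) (h : A → List B) →
                    concatMap h ∘ filterᵇ q ≗ concatMap (λ x → if q x then h x else [])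
concatMap-filterᵇ q h [] = refl
concatMap-filterᵇ q h (x ∷ xs) with q x
... | true  = cong (h x ++_) (concatMap-filterᵇ q h xs)
... | false = concatMap-filterᵇ q h xs

any-++ : {A : Set} (p : A → Bool) (xs ys : List A) → any p (xs ++ ys) ≡ any p xs ∨ any p ys
any-++ p []       ys = refl
any-++ p (x ∷ xs) ys = trans (cong (p x ∨_) (any-++ p xs ys)) (sym (∨-assoc (p x) (any p xs) (any p ys)))

any-map : {A B : Set} (p : B → Bool) (h : A → B) → any p ∘ map h ≗ any (p ∘ h)
any-map p h xs = cong or (sym (map-∘ xs))

any-false : {A : Set} (p : A → Bool) → (∀ x → p x ≡ false) → ∀ xs → any p xs ≡ false
any-false p p≡false []       = refl
any-false p p≡false (x ∷ xs) rewrite p≡false x = any-false p p≡false xs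

-- The shift e ↦ 0(e+1) of inversion sequences

count-++ : ∀ v xs ys → count v (xs ++ ys) ≡ count v xs + count v ys
count-++ v xs ys = trans (cong length (filter-++ _ xs ys)) (length-++ (filterᵇ (λ y → y ≡ᵇ v) xs))

count-map-suc : ∀ v e → count (suc v) (map suc e) ≡ count v e
count-map-suc v e = trans (cong length (filterᵇ-map (λ y → y ≡ᵇ suc v) suc e)) (length-map suc (filterᵇ (λ y → y ≡ᵇ v) e))

count-zero-map-suc : ∀ e → count 0 (map suc e) ≡ 0
count-zero-map-suc []      = refl
count-zero-map-suc (_ ∷ e) = count-zero-map-suc e

shift : List ℕ → List ℕ
shift e = 0 ∷ map suc e

extend : ℕ → List ℕ → List (List ℕ)
extend n e = map (λ v → e ++ [ v ]) (upTo n)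

extend⁺ : ℕ → List ℕ → List (List ℕ)
extend⁺ n e = map (λ v → e ++ [ suc v ]) (upTo n)

extend⁺-shift : ∀ n e → extend⁺ n (shift e) ≡ map shift (extend n e)
extend⁺-shift n e = trans (map-cong (λ v → cong (0 ∷_) (sym (map-++ suc e [ v ]))) (upTo n)) (map-∘ (upTo n))

StartsWithZero : List ℕ → Set
StartsWithZero e = ∃[ t ] e ≡ 0 ∷ t

invSeqs-startWithZero : ∀ m → All StartsWithZero (invSeqs (suc m))
invSeqs-startWithZero zero    = ([] , refl) ∷ []
invSeqs-startWithZero (suc m) = concat⁺ (map⁺ (All.map extend-startsWithZero (invSeqs-startWithZero m)))
  where
  extend-startsWithZero : ∀ {e} → StartsWithZero e → All StartsWithZero (extend (suc (suc m)) e)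
  extend-startsWithZero (t , refl) = map⁺ (All.universal (λ v → t ++ [ v ] , refl) (upTo (suc (suc m))))

zeroUnrepeated : List ℕ → Bool
zeroUnrepeated e = not (repeated e 0)

zeroUnrepeated-snoc-suc : ∀ e v → zeroUnrepeated (e ++ [ suc v ]) ≡ zeroUnrepeated e
zeroUnrepeated-snoc-suc e v rewrite count-++ 0 e [ suc v ] | +-identityʳ (count 0 e) = refl

zeroUnrepeated-snoc-zero : ∀ t → zeroUnrepeated ((0 ∷ t) ++ [ 0 ]) ≡ false
zeroUnrepeated-snoc-zero t rewrite count-++ 0 t [ 0 ] | +-comm (count 0 t) 1 = refl

filter-extend : ∀ n {e} → StartsWithZero e →
                filterᵇ zeroUnrepeated (extend (suc n) e) ≡ (if zeroUnrepeated e then extend⁺ n e else [])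
filter-extend n {e} (t , refl) = begin
  filterᵇ zeroUnrepeated (extend (suc n) e)
    ≡⟨ filterᵇ-reject zeroUnrepeated {e ++ [ 0 ]} (map (λ v → e ++ [ v ]) (applyUpTo suc n)) (zeroUnrepeated-snoc-zero t) ⟩
  filterᵇ zeroUnrepeated (map (λ v → e ++ [ v ]) (applyUpTo suc n))
    ≡⟨ cong (filterᵇ zeroUnrepeated) (trans (map-applyUpTo suc _ n) (sym (map-applyUpTo id _ n))) ⟩
  filterᵇ zeroUnrepeated (extend⁺ n e)
    ≡⟨ filterᵇ-map zeroUnrepeated _ (upTo n) ⟩
  map (λ v → e ++ [ suc v ]) (filterᵇ (λ v → zeroUnrepeated (e ++ [ suc v ])) (upTo n))
    ≡⟨ cong (map _) (filterᵇ-const _ (zeroUnrepeated e) (zeroUnrepeated-snoc-suc e) (upTo n)) ⟩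
  map (λ v → e ++ [ suc v ]) (if zeroUnrepeated e then upTo n else [])
    ≡⟨ if-float (map _) (zeroUnrepeated e) ⟩
  (if zeroUnrepeated e then extend⁺ n e else []) ∎

filter-zeroUnrepeated-invSeqs : ∀ m → filterᵇ zeroUnrepeated (invSeqs (suc m)) ≡ map shift (invSeqs m)
filter-zeroUnrepeated-invSeqs zero    = refl
filter-zeroUnrepeated-invSeqs (suc m) = begin
  filterᵇ zeroUnrepeated (concatMap (extend (suc (suc m))) L)
    ≡⟨ filterᵇ-concatMap zeroUnrepeated (extend (suc (suc m))) L ⟩
  concatMap (filterᵇ zeroUnrepeated ∘ extend (suc (suc m))) L
    ≡⟨ cong concat (map-cong-local (All.map (filter-extend (suc m)) (invSeqs-startWithZero m))) ⟩
  concatMap (λ e → if zeroUnrepeated e then extend⁺ (suc m) e else []) L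
    ≡⟨ concatMap-filterᵇ zeroUnrepeated (extend⁺ (suc m)) L ⟨
  concatMap (extend⁺ (suc m)) (filterᵇ zeroUnrepeated L)
    ≡⟨ cong (concatMap (extend⁺ (suc m))) (filter-zeroUnrepeated-invSeqs m) ⟩
  concatMap (extend⁺ (suc m)) (map shift (invSeqs m))
    ≡⟨ concatMap-map (extend⁺ (suc m)) shift (invSeqs m) ⟩
  concatMap (extend⁺ (suc m) ∘ shift) (invSeqs m)
    ≡⟨ concatMap-cong (extend⁺-shift (suc m)) (invSeqs m) ⟩
  concatMap (map shift ∘ extend (suc m)) (invSeqs m)
    ≡⟨ map-concatMap shift (extend (suc m)) (invSeqs m) ⟨
  map shift (invSeqs (suc m)) ∎
  where
  L : List (List ℕ)
  L = invSeqs (suc m)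

deduplicateᵇ-map-suc : deduplicateᵇ _≡ᵇ_ ∘ map suc ≗ map suc ∘ deduplicateᵇ _≡ᵇ_
deduplicateᵇ-map-suc []      = refl
deduplicateᵇ-map-suc (x ∷ t) = cong (suc x ∷_) (begin
  filter (¬? ∘ T? ∘ (suc x ≡ᵇ_)) (deduplicateᵇ _≡ᵇ_ (map suc t))
    ≡⟨ cong (filter (¬? ∘ T? ∘ (suc x ≡ᵇ_))) (deduplicateᵇ-map-suc t) ⟩
  filter (¬? ∘ T? ∘ (suc x ≡ᵇ_)) (map suc (deduplicateᵇ _≡ᵇ_ t))
    ≡⟨ filter-map (¬? ∘ T? ∘ (x ≡ᵇ_)) (¬? ∘ T? ∘ (suc x ≡ᵇ_)) suc (λ _ → refl) (deduplicateᵇ _≡ᵇ_ t) ⟩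
  map suc (filter (¬? ∘ T? ∘ (x ≡ᵇ_)) (deduplicateᵇ _≡ᵇ_ t)) ∎)

rank : List ℕ → ℕ → ℕ
rank w x = length (deduplicateᵇ _≡ᵇ_ (filterᵇ (λ y → y <ᵇ x) w))

reduce-map-suc : ∀ s → reduce (map suc s) ≡ reduce s
reduce-map-suc s = trans (sym (map-∘ s)) (map-cong rank-suc s)
  where
  rank-suc : ∀ x → rank (map suc s) (suc x) ≡ rank s x
  rank-suc x = begin
    length (deduplicateᵇ _≡ᵇ_ (filterᵇ (λ y → y <ᵇ suc x) (map suc s)))
      ≡⟨ cong (length ∘ deduplicateᵇ _≡ᵇ_) (filterᵇ-map (λ y → y <ᵇ suc x) suc s) ⟩
    length (deduplicateᵇ _≡ᵇ_ (map suc (filterᵇ (λ y → y <ᵇ x) s)))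
      ≡⟨ cong length (deduplicateᵇ-map-suc (filterᵇ (λ y → y <ᵇ x) s)) ⟩
    length (map suc (deduplicateᵇ _≡ᵇ_ (filterᵇ (λ y → y <ᵇ x) s)))
      ≡⟨ length-map suc (deduplicateᵇ _≡ᵇ_ (filterᵇ (λ y → y <ᵇ x) s)) ⟩
    rank s x ∎

subseqs-map : (h : ℕ → ℕ) → subseqs ∘ map h ≗ map (map h) ∘ subseqs
subseqs-map h []      = refl
subseqs-map h (x ∷ e) = begin
  map (h x ∷_) (subseqs (map h e)) ++ subseqs (map h e)
    ≡⟨ cong (λ ss → map (h x ∷_) ss ++ ss) (subseqs-map h e) ⟩
  map (h x ∷_) (map (map h) ss) ++ map (map h) ss
    ≡⟨ cong (_++ map (map h) ss) (trans (sym (map-∘ ss)) (map-∘ ss)) ⟩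
  map (map h) (map (x ∷_) ss) ++ map (map h) ss
    ≡⟨ map-++ (map h) (map (x ∷_) ss) ss ⟨
  map (map h) (subseqs (x ∷ e)) ∎
  where
  ss : List (List ℕ)
  ss = subseqs e

listEq-mismatch : ∀ a b r p → (b ≡ᵇ 0) ≡ false → listEq (a ∷ b ∷ r) (0 ∷ 0 ∷ p) ≡ false
listEq-mismatch a b r p b≢0 rewrite b≢0 = ∧-zeroʳ (a ≡ᵇ 0)

-- In a subsequence through the leading 0 of a shifted sequence that 0 is the
-- only minimal entry, so the second entry of the reduction is positive.
reduce-shift-mismatch : ∀ p s → listEq (reduce (0 ∷ map suc s)) (0 ∷ 0 ∷ p) ≡ false
reduce-shift-mismatch p []      = refl
reduce-shift-mismatch p (x ∷ s) = listEq-mismatch (rank w 0) (rank w (suc x)) (map (rank w) (map suc s)) p refl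
  where
  w : List ℕ
  w = 0 ∷ map suc (x ∷ s)

contains-shift : ∀ p e → contains (0 ∷ 0 ∷ p) (shift e) ≡ contains (0 ∷ 0 ∷ p) e
contains-shift p e = begin
  any matches (map (0 ∷_) (subseqs (map suc e)) ++ subseqs (map suc e))
    ≡⟨ any-++ matches (map (0 ∷_) (subseqs (map suc e))) (subseqs (map suc e)) ⟩
  any matches (map (0 ∷_) (subseqs (map suc e))) ∨ any matches (subseqs (map suc e))
    ≡⟨ cong₂ _∨_ through-leading-zero avoiding-leading-zero ⟩
  false ∨ any matches (subseqs e) ∎
  where
  matches : List ℕ → Bool
  matches s = listEq (reduce s) (0 ∷ 0 ∷ p)
  through-leading-zero : any matches (map (0 ∷_) (subseqs (map suc e))) ≡ false
  through-leading-zero = begin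
    any matches (map (0 ∷_) (subseqs (map suc e)))
      ≡⟨ cong (any matches ∘ map (0 ∷_)) (subseqs-map suc e) ⟩
    any matches (map (0 ∷_) (map (map suc) (subseqs e)))
      ≡⟨ any-map matches (0 ∷_) (map (map suc) (subseqs e)) ⟩
    any (matches ∘ (0 ∷_)) (map (map suc) (subseqs e))
      ≡⟨ any-map (matches ∘ (0 ∷_)) (map suc) (subseqs e) ⟩
    any (λ s → matches (0 ∷ map suc s)) (subseqs e)
      ≡⟨ any-false _ (reduce-shift-mismatch p) (subseqs e) ⟩
    false ∎
  avoiding-leading-zero : any matches (subseqs (map suc e)) ≡ any matches (subseqs e)
  avoiding-leading-zero = begin
    any matches (subseqs (map suc e))
      ≡⟨ cong (any matches) (subseqs-map suc e) ⟩
    any matches (map (map suc) (subseqs e))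
      ≡⟨ any-map matches (map suc) (subseqs e) ⟩
    any (matches ∘ map suc) (subseqs e)
      ≡⟨ cong or (map-cong (λ s → cong (λ r → listEq r (0 ∷ 0 ∷ p)) (reduce-map-suc s)) (subseqs e)) ⟩
    any matches (subseqs e) ∎

repeated-shift-zero : ∀ e → repeated (shift e) 0 ≡ false
repeated-shift-zero e rewrite count-zero-map-suc e = refl

repeated-shift-suc : ∀ e v → repeated (shift e) (suc v) ≡ repeated e v
repeated-shift-suc e v = cong (2 ≤ᵇ_) (count-map-suc v e)

firstOr-map : (h : ℕ → ℕ) (d : ℕ) (R : ℕ → Bool) (xs : List ℕ) → firstOr (h d) R (map h xs) ≡ h (firstOr d (R ∘ h) xs)
firstOr-map h d R [] = refl
firstOr-map h d R (x ∷ xs) with R (h x)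
... | true  = refl
... | false = firstOr-map h d R xs

firstOr-cong : ∀ d {R R′ : ℕ → Bool} → (∀ v → R v ≡ R′ v) → ∀ xs → firstOr d R xs ≡ firstOr d R′ xs
firstOr-cong d R≡R′ []       = refl
firstOr-cong d {R′ = R′} R≡R′ (x ∷ xs) rewrite R≡R′ x = cong (if R′ x then x else_) (firstOr-cong d R≡R′ xs)

srpt-shift : ∀ m e → srpt (suc (suc m)) (shift e) ≡ suc (srpt (suc m) e)
srpt-shift m e = begin
  (if R 0 then 0 else firstOr (suc m) R (applyUpTo suc (suc m)))
    ≡⟨ cong (λ b → if b then 0 else firstOr (suc m) R (applyUpTo suc (suc m))) (repeated-shift-zero e) ⟩
  firstOr (suc m) R (applyUpTo suc (suc m))
    ≡⟨ cong (firstOr (suc m) R) (map-applyUpTo id suc (suc m)) ⟨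
  firstOr (suc m) R (map suc (upTo (suc m)))
    ≡⟨ firstOr-map suc m R (upTo (suc m)) ⟩
  suc (firstOr m (R ∘ suc) (upTo (suc m)))
    ≡⟨ cong suc (firstOr-cong m (repeated-shift-suc e) (upTo (suc m))) ⟩
  suc (srpt (suc m) e) ∎
  where
  R : ℕ → Bool
  R = repeated (shift e)

srpt-zeroRepeated : ∀ m e → repeated e 0 ≡ true → srpt (suc m) e ≡ 0
srpt-zeroRepeated m e rep rewrite rep = refl

lastOf-map : (h : ℕ → ℕ) (x : ℕ) (xs : List ℕ) → lastOf (map h (x ∷ xs)) ≡ h (lastOf (x ∷ xs))
lastOf-map h x []       = refl
lastOf-map h x (y ∷ xs) = lastOf-map h y xs

hasStatistics : ℕ → ℕ → ℕ → List ℕ → Bool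
hasStatistics n k ℓ e = avoids p0012 e ∧ ((srpt n e ≡ᵇ k) ∧ (lastOf e ≡ᵇ ℓ))

hasStatistics-zeroRepeated : ∀ m k ℓ e → repeated e 0 ≡ true → hasStatistics (suc m) (suc k) ℓ e ≡ false
hasStatistics-zeroRepeated m k ℓ e rep rewrite srpt-zeroRepeated m e rep = ∧-zeroʳ (avoids p0012 e)

hasStatistics-shift : ∀ m k ℓ {e} → StartsWithZero e →
                      hasStatistics (suc (suc m)) (suc k) (suc ℓ) (shift e) ≡ hasStatistics (suc m) k ℓ e
hasStatistics-shift m k ℓ (t , refl) =
  cong₂ _∧_ (cong not (contains-shift (1 ∷ 2 ∷ []) (0 ∷ t)))
            (cong₂ _∧_ (cong (_≡ᵇ suc k) (srpt-shift m (0 ∷ t))) (cong (_≡ᵇ suc ℓ) (lastOf-map suc 0 t)))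

f-suc-suc : ∀ m k ℓ → f (suc (suc m)) (suc k) (suc ℓ) ≡ f (suc m) k ℓ
f-suc-suc m k ℓ = begin
  length (filterᵇ S (invSeqs (suc (suc m))))
    ≡⟨ cong length (filterᵇ-absorb S zeroUnrepeated
         (λ e → hasStatistics-zeroRepeated (suc m) k (suc ℓ) e ∘ not-injective) (invSeqs (suc (suc m)))) ⟨
  length (filterᵇ S (filterᵇ zeroUnrepeated (invSeqs (suc (suc m)))))
    ≡⟨ cong (length ∘ filterᵇ S) (filter-zeroUnrepeated-invSeqs (suc m)) ⟩
  length (filterᵇ S (map shift (invSeqs (suc m))))
    ≡⟨ cong length (filterᵇ-map S shift (invSeqs (suc m))) ⟩
  length (map shift (filterᵇ (S ∘ shift) (invSeqs (suc m))))
    ≡⟨ length-map shift (filterᵇ (S ∘ shift) (invSeqs (suc m))) ⟩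
  length (filterᵇ (S ∘ shift) (invSeqs (suc m)))
    ≡⟨ cong length (filterᵇ-cong-local (All.map (hasStatistics-shift m k ℓ) (invSeqs-startWithZero m))) ⟩
  f (suc m) k ℓ ∎
  where
  S : List ℕ → Bool
  S = hasStatistics (suc (suc m)) (suc k) (suc ℓ)

Σℤ-cong : ∀ {g h : ℕ → ℤ} → (∀ i → g i ≡ h i) → ∀ xs → Σℤ xs g ≡ Σℤ xs h
Σℤ-cong g≡h []       = refl
Σℤ-cong g≡h (x ∷ xs) = cong₂ _+ℤ_ (g≡h x) (Σℤ-cong g≡h xs)

Σℤ-zero : ∀ {g : ℕ → ℤ} → (∀ i → g i ≡ + 0) → ∀ xs → Σℤ xs g ≡ + 0
Σℤ-zero g≡0 []       = refl
Σℤ-zero g≡0 (x ∷ xs) = cong₂ _+ℤ_ (g≡0 x) (Σℤ-zero g≡0 xs)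

Σℤ-map : (h : ℕ → ℕ) (g : ℕ → ℤ) (xs : List ℕ) → Σℤ (map h xs) g ≡ Σℤ xs (g ∘ h)
Σℤ-map h g = foldr-map _ h (+ 0)

Σℤ-upTo-suc : ∀ (g : ℕ → ℤ) n → Σℤ (upTo (suc n)) g ≡ g 0 +ℤ Σℤ (upTo n) (g ∘ suc)
Σℤ-upTo-suc g n = cong (g 0 +ℤ_) (trans (cong (λ xs → Σℤ xs g) (sym (map-applyUpTo id suc n))) (Σℤ-map suc g (upTo n)))

Σℤ-+ : ∀ (g h : ℕ → ℤ) xs → Σℤ xs (λ i → g i +ℤ h i) ≡ Σℤ xs g +ℤ Σℤ xs h
Σℤ-+ g h []       = refl
Σℤ-+ g h (x ∷ xs) = trans (cong (g x +ℤ h x +ℤ_) (Σℤ-+ g h xs)) (interchange (g x) (h x) (Σℤ xs g) (Σℤ xs h))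

Σℤ-swap : ∀ (g : ℕ → ℕ → ℤ) xs ys → Σℤ xs (λ i → Σℤ ys (g i)) ≡ Σℤ ys (λ j → Σℤ xs (λ i → g i j))
Σℤ-swap g []       ys = sym (Σℤ-zero (λ _ → refl) ys)
Σℤ-swap g (x ∷ xs) ys =
  trans (cong (Σℤ ys (g x) +ℤ_) (Σℤ-swap g xs ys)) (sym (Σℤ-+ (g x) (λ j → Σℤ xs (λ i → g i j)) ys))

-- Bivariate power series

-- + 0 *ℤ i reduces to + 0, so sums of such terms vanish by Σℤ-zero (λ _ → refl).

XFree : Series → Set
XFree S = ∀ n k → S n (suc k) ≡ + 0

ShiftInvariant : Series → Set
ShiftInvariant S = ∀ n k → S (suc n) (suc k) ≡ S n k

shiftInvariant-unique : ∀ {S T} → ShiftInvariant S → ShiftInvariant T →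
                        (∀ k → S 0 k ≡ T 0 k) → (∀ n → S n 0 ≡ T n 0) → ∀ n k → S n k ≡ T n k
shiftInvariant-unique S-inv T-inv row col zero    k       = row k
shiftInvariant-unique S-inv T-inv row col (suc n) zero    = col (suc n)
shiftInvariant-unique {S} {T} S-inv T-inv row col (suc n) (suc k) = begin
  S (suc n) (suc k)  ≡⟨ S-inv n k ⟩
  S n k              ≡⟨ shiftInvariant-unique S-inv T-inv row col n k ⟩
  T n k              ≡⟨ T-inv n k ⟨
  T (suc n) (suc k)  ∎

⊛-xFreeˡ : ∀ A S → XFree A → ∀ n k → (A ⊛ S) n k ≡ Σℤ (upTo (suc n)) (λ i → A i 0 *ℤ S (n ∸ i) k)
⊛-xFreeˡ A S A-xFree n k = Σℤ-cong constant-term (upTo (suc n))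
  where
  constant-term : ∀ i → Σℤ (upTo (suc k)) (λ j → A i j *ℤ S (n ∸ i) (k ∸ j)) ≡ A i 0 *ℤ S (n ∸ i) k
  constant-term i = begin
    Σℤ (upTo (suc k)) (λ j → A i j *ℤ S (n ∸ i) (k ∸ j))
      ≡⟨ Σℤ-upTo-suc (λ j → A i j *ℤ S (n ∸ i) (k ∸ j)) k ⟩
    A i 0 *ℤ S (n ∸ i) k +ℤ Σℤ (upTo k) (λ j → A i (suc j) *ℤ S (n ∸ i) (k ∸ suc j))
      ≡⟨ cong (A i 0 *ℤ S (n ∸ i) k +ℤ_) (Σℤ-zero higher-terms (upTo k)) ⟩
    A i 0 *ℤ S (n ∸ i) k +ℤ + 0
      ≡⟨ ℤ.+-identityʳ (A i 0 *ℤ S (n ∸ i) k) ⟩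
    A i 0 *ℤ S (n ∸ i) k ∎
    where
    higher-terms : ∀ j → A i (suc j) *ℤ S (n ∸ i) (k ∸ suc j) ≡ + 0
    higher-terms j = trans (cong (_*ℤ S (n ∸ i) (k ∸ suc j)) (A-xFree i j)) (ℤ.*-zeroˡ (S (n ∸ i) (k ∸ suc j)))

⊛-xFree : ∀ A S → XFree A → XFree S → XFree (A ⊛ S)
⊛-xFree A S A-xFree S-xFree n k =
  trans (⊛-xFreeˡ A S A-xFree n (suc k))
        (Σℤ-zero (λ i → trans (cong (A i 0 *ℤ_) (S-xFree (n ∸ i) k)) (ℤ.*-zeroʳ (A i 0))) (upTo (suc n)))

oneMinusQ-xFree : XFree oneMinusQ
oneMinusQ-xFree zero          k = refl
oneMinusQ-xFree (suc zero)    k = refl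
oneMinusQ-xFree (suc (suc n)) k = refl

oneMinusQ-⊛-zero : ∀ S k → (oneMinusQ ⊛ S) 0 k ≡ S 0 k
oneMinusQ-⊛-zero S k = begin
  (oneMinusQ ⊛ S) 0 k      ≡⟨ ⊛-xFreeˡ oneMinusQ S oneMinusQ-xFree 0 k ⟩
  + 1 *ℤ S 0 k +ℤ + 0      ≡⟨ ℤ.+-identityʳ (+ 1 *ℤ S 0 k) ⟩
  + 1 *ℤ S 0 k             ≡⟨ ℤ.*-identityˡ (S 0 k) ⟩
  S 0 k                    ∎

oneMinusQ-⊛-suc : ∀ S n k → (oneMinusQ ⊛ S) (suc n) k ≡ S (suc n) k - S n k
oneMinusQ-⊛-suc S n k = begin
  (oneMinusQ ⊛ S) (suc n) k
    ≡⟨ ⊛-xFreeˡ oneMinusQ S oneMinusQ-xFree (suc n) k ⟩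
  Σℤ (upTo (suc (suc n))) term
    ≡⟨ Σℤ-upTo-suc term (suc n) ⟩
  term 0 +ℤ Σℤ (upTo (suc n)) (term ∘ suc)
    ≡⟨ cong (term 0 +ℤ_) (Σℤ-upTo-suc (term ∘ suc) n) ⟩
  term 0 +ℤ (term 1 +ℤ Σℤ (upTo n) (term ∘ suc ∘ suc))
    ≡⟨ cong (λ t → term 0 +ℤ (term 1 +ℤ t)) (Σℤ-zero (λ _ → refl) (upTo n)) ⟩
  + 1 *ℤ S (suc n) k +ℤ (-[1+ 0 ] *ℤ S n k +ℤ + 0)
    ≡⟨ cong₂ _+ℤ_ (ℤ.*-identityˡ (S (suc n) k)) (trans (ℤ.+-identityʳ (-[1+ 0 ] *ℤ S n k)) (ℤ.-1*i≡-i (S n k))) ⟩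
  S (suc n) k - S n k ∎
  where
  term : ℕ → ℤ
  term i = oneMinusQ i 0 *ℤ S (suc n ∸ i) k

Σ-geomXQ-zero : ∀ (T : ℕ → ℤ) k → Σℤ (upTo (suc k)) (λ j → geomXQ 0 j *ℤ T (k ∸ j)) ≡ T k
Σ-geomXQ-zero T k = begin
  Σℤ (upTo (suc k)) (λ j → geomXQ 0 j *ℤ T (k ∸ j))
    ≡⟨ Σℤ-upTo-suc (λ j → geomXQ 0 j *ℤ T (k ∸ j)) k ⟩
  + 1 *ℤ T k +ℤ Σℤ (upTo k) (λ j → + 0 *ℤ T (k ∸ suc j))
    ≡⟨ cong₂ _+ℤ_ (ℤ.*-identityˡ (T k)) (Σℤ-zero (λ _ → refl) (upTo k)) ⟩
  T k +ℤ + 0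
    ≡⟨ ℤ.+-identityʳ (T k) ⟩
  T k ∎

geomXQ-⊛-row₀ : ∀ S k → (geomXQ ⊛ S) 0 k ≡ S 0 k
geomXQ-⊛-row₀ S k = trans (ℤ.+-identityʳ (Σℤ (upTo (suc k)) (λ j → geomXQ 0 j *ℤ S 0 (k ∸ j)))) (Σ-geomXQ-zero (S 0) k)

geomXQ-⊛-col₀ : ∀ S n → (geomXQ ⊛ S) n 0 ≡ S n 0
geomXQ-⊛-col₀ S n = begin
  (geomXQ ⊛ S) n 0
    ≡⟨ Σℤ-upTo-suc (λ i → Σℤ (upTo 1) (λ j → geomXQ i j *ℤ S (n ∸ i) (0 ∸ j))) n ⟩
  Σℤ (upTo 1) (λ j → geomXQ 0 j *ℤ S n (0 ∸ j)) +ℤ Σℤ (upTo n) (λ i → + 0 *ℤ S (n ∸ suc i) 0 +ℤ + 0)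
    ≡⟨ cong₂ _+ℤ_ (Σ-geomXQ-zero (S n) 0) (Σℤ-zero (λ _ → refl) (upTo n)) ⟩
  S n 0 +ℤ + 0
    ≡⟨ ℤ.+-identityʳ (S n 0) ⟩
  S n 0 ∎

-- 1/(1 - xq) = 1 + xq/(1 - xq)
geomXQ-⊛-suc-suc : ∀ S n k → (geomXQ ⊛ S) (suc n) (suc k) ≡ S (suc n) (suc k) +ℤ (geomXQ ⊛ S) n k
geomXQ-⊛-suc-suc S n k = begin
  (geomXQ ⊛ S) (suc n) (suc k)
    ≡⟨ Σℤ-upTo-suc (λ i → Σℤ (upTo (suc (suc k))) (λ j → geomXQ i j *ℤ S (suc n ∸ i) (suc k ∸ j))) (suc n) ⟩
  Σℤ (upTo (suc (suc k))) (λ j → geomXQ 0 j *ℤ S (suc n) (suc k ∸ j)) +ℤ Σℤ (upTo (suc n)) later-rows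
    ≡⟨ cong₂ _+ℤ_ (Σ-geomXQ-zero (S (suc n)) (suc k)) (Σℤ-cong drop-first-column (upTo (suc n))) ⟩
  S (suc n) (suc k) +ℤ (geomXQ ⊛ S) n k ∎
  where
  later-rows : ℕ → ℤ
  later-rows i = Σℤ (upTo (suc (suc k))) (λ j → geomXQ (suc i) j *ℤ S (n ∸ i) (suc k ∸ j))
  drop-first-column : ∀ i → later-rows i ≡ Σℤ (upTo (suc k)) (λ j → geomXQ i j *ℤ S (n ∸ i) (k ∸ j))
  drop-first-column i = trans (Σℤ-upTo-suc (λ j → geomXQ (suc i) j *ℤ S (n ∸ i) (suc k ∸ j)) (suc k)) (ℤ.+-identityˡ _)

geomXQ-⊛-shiftInvariant : ∀ S → XFree S → ShiftInvariant (geomXQ ⊛ S)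
geomXQ-⊛-shiftInvariant S S-xFree n k = begin
  (geomXQ ⊛ S) (suc n) (suc k)           ≡⟨ geomXQ-⊛-suc-suc S n k ⟩
  S (suc n) (suc k) +ℤ (geomXQ ⊛ S) n k  ≡⟨ cong (_+ℤ (geomXQ ⊛ S) n k) (S-xFree (suc n) k) ⟩
  + 0 +ℤ (geomXQ ⊛ S) n k                ≡⟨ ℤ.+-identityˡ ((geomXQ ⊛ S) n k) ⟩
  (geomXQ ⊛ S) n k                       ∎

<ᵇ-suc : ∀ k ℓ → (k <ᵇ suc ℓ) ≡ (k ≤ᵇ ℓ)
<ᵇ-suc zero    ℓ = refl
<ᵇ-suc (suc k) ℓ = refl

Fcoef-suc-suc : ∀ n k ℓ → Fcoef (suc n) (suc k) (suc ℓ) ≡ Fcoef n k ℓ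
Fcoef-suc-suc zero    k ℓ rewrite ∧-zeroʳ (k <ᵇ suc ℓ) = refl
Fcoef-suc-suc (suc m) k ℓ rewrite <ᵇ-suc k ℓ | <ᵇ-suc ℓ m | f-suc-suc m k ℓ = refl

Fx1-shiftInvariant : ShiftInvariant Fx1
Fx1-shiftInvariant n k = begin
  Fx1 (suc n) (suc k)
    ≡⟨ Σℤ-upTo-suc (Fcoef (suc n) (suc k)) n ⟩
  + 0 +ℤ Σℤ (upTo n) (Fcoef (suc n) (suc k) ∘ suc)
    ≡⟨ ℤ.+-identityˡ _ ⟩
  Σℤ (upTo n) (Fcoef (suc n) (suc k) ∘ suc)
    ≡⟨ Σℤ-cong (Fcoef-suc-suc n k) (upTo n) ⟩
  Fx1 n k ∎

F11-xFree : XFree F11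
F11-xFree n k = refl

F11-suc : ∀ n → F11 (suc n) 0 ≡ Fx1 (suc n) 0 +ℤ F11 n 0
F11-suc n = begin
  F11 (suc n) 0
    ≡⟨ Σℤ-swap (λ ℓ k → Fcoef (suc n) k ℓ) (upTo (suc n)) (upTo (suc n)) ⟩
  Σℤ (upTo (suc n)) (Fx1 (suc n))
    ≡⟨ Σℤ-upTo-suc (Fx1 (suc n)) n ⟩
  Fx1 (suc n) 0 +ℤ Σℤ (upTo n) (Fx1 (suc n) ∘ suc)
    ≡⟨ cong (Fx1 (suc n) 0 +ℤ_) (Σℤ-cong (Fx1-shiftInvariant n) (upTo n)) ⟩
  Fx1 (suc n) 0 +ℤ Σℤ (upTo n) (Fx1 n)
    ≡⟨ cong (Fx1 (suc n) 0 +ℤ_) (Σℤ-swap (λ ℓ k → Fcoef n k ℓ) (upTo n) (upTo n)) ⟨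
  Fx1 (suc n) 0 +ℤ F11 n 0 ∎

Fx1-col₀ : ∀ n → Fx1 (suc n) 0 ≡ F11 (suc n) 0 - F11 n 0
Fx1-col₀ n = sym (begin
  F11 (suc n) 0 - F11 n 0                    ≡⟨ cong (_- F11 n 0) (F11-suc n) ⟩
  Fx1 (suc n) 0 +ℤ F11 n 0 - F11 n 0         ≡⟨ ℤ.+-assoc (Fx1 (suc n) 0) (F11 n 0) (- F11 n 0) ⟩
  Fx1 (suc n) 0 +ℤ (F11 n 0 - F11 n 0)       ≡⟨ cong (Fx1 (suc n) 0 +ℤ_) (ℤ.+-inverseʳ (F11 n 0)) ⟩
  Fx1 (suc n) 0 +ℤ + 0                       ≡⟨ ℤ.+-identityʳ (Fx1 (suc n) 0) ⟩
  Fx1 (suc n) 0                              ∎)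

F11-zero : ∀ k → F11 0 k ≡ + 0
F11-zero zero    = refl
F11-zero (suc k) = refl

lemma5p2 : (n k : ℕ) → Fx1 n k ≡ (geomXQ ⊛ (oneMinusQ ⊛ F11)) n k
lemma5p2 = shiftInvariant-unique Fx1-shiftInvariant (geomXQ-⊛-shiftInvariant G G-xFree) row₀ col₀
  where
  G : Series
  G = oneMinusQ ⊛ F11
  G-xFree : XFree G
  G-xFree = ⊛-xFree oneMinusQ F11 oneMinusQ-xFree F11-xFree
  row₀ : ∀ k → Fx1 0 k ≡ (geomXQ ⊛ G) 0 k
  row₀ k = sym (begin
    (geomXQ ⊛ G) 0 k  ≡⟨ geomXQ-⊛-row₀ G k ⟩
    G 0 k             ≡⟨ oneMinusQ-⊛-zero F11 k ⟩
    F11 0 k           ≡⟨ F11-zero k ⟩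
    + 0               ∎)
  col₀ : ∀ n → Fx1 n 0 ≡ (geomXQ ⊛ G) n 0
  col₀ zero    = row₀ 0
  col₀ (suc n) = begin
    Fx1 (suc n) 0              ≡⟨ Fx1-col₀ n ⟩
    F11 (suc n) 0 - F11 n 0    ≡⟨ oneMinusQ-⊛-suc F11 n 0 ⟨
    G (suc n) 0                ≡⟨ geomXQ-⊛-col₀ G (suc n) ⟨
    (geomXQ ⊛ G) (suc n) 0     ∎
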